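{- Let $G=(V^+,V^-;E)$ be a bipartite graph with $|V^+|\le|V^-|$ and $|V^-|\ge2$. If $G$ is DM-irreducible, then $|\Gamma_G(\{u\})|\ge2$ for every $u\in V^+$.
   Context: A bipartite graph $G=(V^+,V^-;E)$ has finite disjoint vertex sides $V^+,V^-$, and its edge set satisfies $E\subseteq V^+\times V^-$. For $X\subseteq V^+$, $\Gamma_G(X)$ is the set of vertices of $V^-$ adjacent to some vertex of $X$. DM-decomposition. Define $f_G(X)=|\Gamma_G(X)|-|X|$ for $X\subseteq V^+$. Its minimizers form a lattice under union and intersection. Take a maximal chain $X_0\subsetneq\cdots\subsetneq X_k$ of minimizers and set: - $V_0=X_0\cup\Gamma_G(X_0)$; - $V_i=(X_i\setminus X_{i-1})\cup(\Gamma_G(X_i)\setminus\Gamma_G(X_{i-1}))$ for $i=1,\dots,k$; - $V_\infty=(V^+\setminus X_k)\cup(V^-\setminus\Gamma_G(X_k))$. This partition of $V=V^+\cup V^-$ is independent of the chain. $G$ is DM-irreducible if exactly one part is nonempty, i.e. $V_0=V$, or $V_1=V$, or $V_\infty=V$. -}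

module Defs where

open import Data.Bool using (Bool; true; false; _∧_; _∨_)
open import Data.Nat using (ℕ; zero; suc)
open import Data.Integer as ℤ using (ℤ; +_; _-_)
open import Data.Fin using (Fin; zero; suc; inject₁; fromℕ)
open import Data.Fin.Subset using (Subset; ∣_∣; _⊂_; _─_; ∁; Nonempty; Empty)
open import Data.Vec using (tabulate; lookup)
open import Data.Maybe using (Maybe; just; nothing)
open import Data.Product using (Σ; _×_; ∃)
open import Data.Sum using (_⊎_)
open import Relation.Nullary using (¬_)
open import Relation.Binary.PropositionalEquality using (_≡_; _≢_)

anyFin : ∀ {m} → (Fin m → Bool) → Bool
anyFin {zero}  p = false
anyFin {suc m} p = p zero ∨ anyFin (λ i → p (suc i))

-- A bipartite graph G = (V⁺, V⁻; E) with V⁺ = Fin m, V⁻ = Fin n and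
-- edge set E ⊆ V⁺ × V⁻ given by its (Boolean) indicator E i j.
Edges : ℕ → ℕ → Set
Edges m n = Fin m → Fin n → Bool

module _ {m n : ℕ} (E : Edges m n) where

  Γ : Subset m → Subset n
  Γ X = tabulate (λ j → anyFin (λ i → lookup X i ∧ E i j))

  f : Subset m → ℤ
  f X = + ∣ Γ X ∣ - + ∣ X ∣

  Minimizer : Subset m → Set
  Minimizer X = ∀ Y → f X ℤ.≤ f Y

  record MaxChain : Set where
    field
      k      : ℕ
      X      : Fin (suc k) → Subset m
      minim  : ∀ i → Minimizer (X i)
      incr   : ∀ (i : Fin k) → X (inject₁ i) ⊂ X (suc i)
      bottom : ∀ Y → Minimizer Y → ¬ (Y ⊂ X zero)
      gap    : ∀ (i : Fin k) Y → Minimizer Y → ¬ (X (inject₁ i) ⊂ Y × Y ⊂ X (suc i))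
      top    : ∀ Y → Minimizer Y → ¬ (X (fromℕ k) ⊂ Y)

  -- Parts of the DM-decomposition determined by a maximal chain.
  -- Index  just i  (i = 0,…,k) gives V_i ; index  nothing  gives V_∞.
  -- A part is given by its V⁺-component and its V⁻-component.
  part : (c : MaxChain) → Maybe (Fin (suc (MaxChain.k c))) → Subset m × Subset n
  part c (just zero)    = X zero Data.Product., Γ (X zero)
    where open MaxChain c
  part c (just (suc i)) = (X (suc i) ─ X (inject₁ i)) Data.Product., (Γ (X (suc i)) ─ Γ (X (inject₁ i)))
    where open MaxChain c
  part c nothing        = ∁ (X (fromℕ k)) Data.Product., ∁ (Γ (X (fromℕ k)))
    where open MaxChain c

  PartNonempty : Subset m × Subset n → Set
  PartNonempty (A Data.Product., B) = Nonempty A ⊎ Nonempty B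

  PartEmpty : Subset m × Subset n → Set
  PartEmpty (A Data.Product., B) = Empty A × Empty B

  -- DM-irreducible: (for a maximal chain; the partition is chain-independent)
  -- exactly one part of the DM-decomposition is nonempty.
  DMIrreducible : Set
  DMIrreducible =
    Σ MaxChain λ c → ∃ λ p → PartNonempty (part c p) × (∀ q → q ≢ p → PartEmpty (part c q))

module Submission where

-- Suppose deg u ≤ 1, i.e. f{u} ≤ 0 = f(∅). Take a maximal chain
-- X₀ ⊊ ⋯ ⊊ X_k of minimizers whose decomposition has exactly one
-- nonempty part. Each V_i with i ≥ 1 is nonempty, so k ≤ 1, and the
-- emptiness of the other parts pins the chain down completely:
--   * k = 0, V = V_∞ : X₀ = ∅, so {u} is a minimizer strictly above X₀;
--   * k = 0, V = V₀  : X₀ = V⁺ with Γ(X₀) = V⁻, so f(X₀) = |V⁻|-|V⁺| ≥ 0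
--                      = f(∅) and ∅ is a minimizer strictly below X₀;
--   * k = 1, V = V₁  : X₀ = ∅ and X₁ = V⁺ with Γ(X₁) = V⁻, hence
--                      |V⁻| ≤ |V⁺| and so |V⁺| ≥ 2; then {u} is a minimizer
--                      strictly between X₀ and X₁.
-- Each case contradicts the maximality of the chain.

open import Defs
open import Data.Nat using (ℕ; _≤_; zero; suc; s≤s; _≤?_)
open import Data.Nat.Properties as ℕ using (≮⇒≥)
open import Data.Fin using (Fin; zero; suc; punchIn; fromℕ)
open import Data.Fin.Properties using (punchInᵢ≢i) renaming (_≟_ to _≟ᶠ_)
open import Data.Fin.Subset
  using (Subset; ∣_∣; ⁅_⁆; ⊥; ⊤; ∁; Empty; _∈_; _∉_; _⊂_; outside)
open import Data.Fin.Subset.Properties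
  using ( Empty-unique; ⊆-antisym; ∣⊥∣≡0; ∣⊤∣≡n; ∣⁅x⁆∣≡1; x∈⁅x⁆; x≢y⇒x∉⁅y⁆
        ; ∈⊤; ⊥⊆; ∉⊥; x∉∁p⇒x∈p; x∈p∧x∉q⇒x∈p─q )
open import Data.Vec using (lookup)
open import Data.Vec.Properties using (tabulate-cong; tabulate∘lookup; lookup-replicate)
open import Data.Bool using (Bool; false; _∧_)
open import Data.Integer as ℤ using (+_; _-_)
open import Data.Integer.Properties
  using (≤-trans; i≤j⇒i-j≤0; i≤j⇒0≤j-i; i-j≤0⇒i≤j; drop‿+≤+)
open import Data.Maybe using (Maybe; just; nothing)
open import Data.Maybe.Properties using (≡-dec)
open import Data.Product using (_×_; _,_; proj₁; proj₂; ∃)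
open import Data.Sum using (inj₁; inj₂)
open import Data.Empty using () renaming (⊥ to ⊥′)
open import Relation.Nullary using (¬_)
open import Relation.Nullary.Decidable using (decidable-stable)
open import Relation.Binary.PropositionalEquality
  using (_≡_; _≢_; refl; sym; trans; cong; subst; subst₂)

∁-empty⇒⊤ : ∀ {n} {p : Subset n} → Empty (∁ p) → p ≡ ⊤
∁-empty⇒⊤ e = ⊆-antisym (λ _ → ∈⊤) (λ {x} _ → x∉∁p⇒x∈p (λ x∈∁p → e (x , x∈∁p)))

⊥⊂ : ∀ {n} {p : Subset n} {x : Fin n} → x ∈ p → ⊥ ⊂ p
⊥⊂ {x = x} x∈p = ⊥⊆ , x , x∈p , ∉⊥

⊂⊤ : ∀ {n} {p : Subset n} {x : Fin n} → x ∉ p → p ⊂ ⊤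
⊂⊤ {x = x} x∉p = (λ _ → ∈⊤) , x , ∈⊤ , x∉p

another : ∀ {m} → 2 ≤ m → (u : Fin m) → ∃ λ v → v ≢ u
another (s≤s (s≤s _)) u = punchIn u zero , punchInᵢ≢i u zero

anyFin-false : ∀ {m} (p : Fin m → Bool) → (∀ i → p i ≡ false) → anyFin p ≡ false
anyFin-false {zero}  p all-false = refl
anyFin-false {suc m} p all-false
  rewrite all-false zero = anyFin-false (λ i → p (suc i)) (λ i → all-false (suc i))

module _ {m n : ℕ} (E : Edges m n) where

  Γ-⊥ : Γ E ⊥ ≡ ⊥
  Γ-⊥ = trans (tabulate-cong no-neighbour) (tabulate∘lookup ⊥)
    where
    no-neighbour : ∀ j → anyFin (λ i → lookup ⊥ i ∧ E i j) ≡ lookup (⊥ {n}) j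
    no-neighbour j = trans
      (anyFin-false _ (λ i → cong (_∧ E i j) (lookup-replicate i outside)))
      (sym (lookup-replicate j outside))

  f-⊥ : f E ⊥ ≡ + 0
  f-⊥ rewrite Γ-⊥ | ∣⊥∣≡0 n | ∣⊥∣≡0 m = refl

  f-⊤ : Γ E ⊤ ≡ ⊤ → f E ⊤ ≡ + n - + m
  f-⊤ Γ⊤≡⊤ rewrite Γ⊤≡⊤ | ∣⊤∣≡n n | ∣⊤∣≡n m = refl

  f-⁅u⁆≤0 : (u : Fin m) → ¬ (2 ≤ ∣ Γ E ⁅ u ⁆ ∣) → f E ⁅ u ⁆ ℤ.≤ + 0
  f-⁅u⁆≤0 u deg≱2 rewrite ∣⁅x⁆∣≡1 u = i≤j⇒i-j≤0 (ℤ.+≤+ (≮⇒≥ deg≱2))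

  minimizer-below : ∀ X Y → Minimizer E X → f E Y ℤ.≤ f E X → Minimizer E Y
  minimizer-below X Y min-X fY≤fX Z = ≤-trans fY≤fX (min-X Z)

  singleton-minimizer : Minimizer E ⊥ → (u : Fin m) → ¬ (2 ≤ ∣ Γ E ⁅ u ⁆ ∣) →
    Minimizer E ⁅ u ⁆
  singleton-minimizer min-⊥ u deg≱2 =
    minimizer-below ⊥ ⁅ u ⁆ min-⊥ (subst (f E ⁅ u ⁆ ℤ.≤_) (sym f-⊥) (f-⁅u⁆≤0 u deg≱2))

  ⊥-minimizer : m ≤ n → Γ E ⊤ ≡ ⊤ → Minimizer E ⊤ → Minimizer E ⊥
  ⊥-minimizer m≤n Γ⊤≡⊤ min-⊤ = minimizer-below ⊤ ⊥ min-⊤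
    (subst₂ ℤ._≤_ (sym f-⊥) (sym (f-⊤ Γ⊤≡⊤)) (i≤j⇒0≤j-i {+ m} {+ n} (ℤ.+≤+ m≤n)))

  -- A minimizer V⁺ covering V⁻ forces |V⁻| ≤ |V⁺|, by comparison with ∅.
  covering-minimizer⇒n≤m : Γ E ⊤ ≡ ⊤ → Minimizer E ⊤ → n ≤ m
  covering-minimizer⇒n≤m Γ⊤≡⊤ min-⊤ = drop‿+≤+ (i-j≤0⇒i≤j {+ n} {+ m}
    (subst₂ ℤ._≤_ (f-⊤ Γ⊤≡⊤) f-⊥ (min-⊤ ⊥)))

module _ {m n : ℕ} {E : Edges m n} where
  open MaxChain

  Index : MaxChain E → Set
  Index c = Maybe (Fin (suc (k c)))

  OthersEmpty : (c : MaxChain E) → Index c → Set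
  OthersEmpty c p = ∀ q → q ≢ p → PartEmpty E (part E c q)

  empty∧nonempty : (P : Subset m × Subset n) → PartEmpty E P → PartNonempty E P → ⊥′
  empty∧nonempty _ (A-empty , _) (inj₁ A-nonempty) = A-empty A-nonempty
  empty∧nonempty _ (_ , B-empty) (inj₂ B-nonempty) = B-empty B-nonempty

  -- The parts V₁, …, V_k are nonempty because the chain is strictly increasing.
  proper-part-nonempty : (c : MaxChain E) (j : Fin (k c)) →
    PartNonempty E (part E c (just (suc j)))
  proper-part-nonempty c j with incr c j
  ... | _ , x , x∈X₊ , x∉X₋ = inj₁ (x , x∈p∧x∉q⇒x∈p─q x∈X₊ x∉X₋)

  proper-part-index : (c : MaxChain E) {p : Index c} → OthersEmpty c p →
    (j : Fin (k c)) → just (suc j) ≡ p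
  proper-part-index c {p} others j =
    decidable-stable (≡-dec _≟ᶠ_ (just (suc j)) p)
      (λ j≢p → empty∧nonempty _ (others _ j≢p) (proper-part-nonempty c j))

  chain-starts-at-⊥ : (c : MaxChain E) {p : Index c} → OthersEmpty c p →
    just zero ≢ p → X c zero ≡ ⊥ × Minimizer E ⊥
  chain-starts-at-⊥ c others 0≢p = X₀≡⊥ , subst (Minimizer E) X₀≡⊥ (minim c zero)
    where
    X₀≡⊥ : X c zero ≡ ⊥
    X₀≡⊥ = Empty-unique (proj₁ (others (just zero) 0≢p))

  chain-ends-at-⊤ : (c : MaxChain E) {p : Index c} → OthersEmpty c p →
    nothing ≢ p → X c (fromℕ (k c)) ≡ ⊤ × Minimizer E ⊤ × Γ E ⊤ ≡ ⊤
  chain-ends-at-⊤ c others ∞≢p =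
    Xₖ≡⊤ , subst (Minimizer E) Xₖ≡⊤ (minim c (fromℕ (k c))) ,
    subst (λ Y → Γ E Y ≡ ⊤) Xₖ≡⊤ (∁-empty⇒⊤ (proj₂ V∞-empty))
    where
    V∞-empty : PartEmpty E (part E c nothing)
    V∞-empty = others nothing ∞≢p
    Xₖ≡⊤ : X c (fromℕ (k c)) ≡ ⊤
    Xₖ≡⊤ = ∁-empty⇒⊤ (proj₁ V∞-empty)

module _ {m n : ℕ} {E : Edges m n} where
  open MaxChain

  no-low-degree : m ≤ n → 2 ≤ n → (c : MaxChain E) (p : Index c) → OthersEmpty c p →
    (u : Fin m) → ¬ ¬ (2 ≤ ∣ Γ E ⁅ u ⁆ ∣)
  -- V = V_∞ with k = 0: {u} is a minimizer strictly above X₀ = ∅.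
  no-low-degree _ _ c@record { k = zero } nothing others u deg≱2
    with chain-starts-at-⊥ c others (λ ())
  ... | X₀≡⊥ , min-⊥ =
    top c ⁅ u ⁆ (singleton-minimizer E min-⊥ u deg≱2)
      (subst (_⊂ ⁅ u ⁆) (sym X₀≡⊥) (⊥⊂ (x∈⁅x⁆ u)))
  -- V = V₀ with k = 0: ∅ is a minimizer strictly below X₀ = V⁺.
  no-low-degree m≤n _ c@record { k = zero } (just zero) others u _
    with chain-ends-at-⊤ c others (λ ())
  ... | X₀≡⊤ , min-⊤ , Γ⊤≡⊤ =
    bottom c ⊥ (⊥-minimizer E m≤n Γ⊤≡⊤ min-⊤)
      (subst (⊥ ⊂_) (sym X₀≡⊤) (⊥⊂ (∈⊤ {x = u})))
  -- V = V₁ with k = 1: {u} is a minimizer strictly between X₀ = ∅ and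
  -- X₁ = V⁺, which has a second vertex v since |V⁺| ≥ |V⁻| ≥ 2.
  no-low-degree _ 2≤n c@record { k = suc zero } (just (suc zero)) others u deg≱2
    with chain-starts-at-⊥ c others (λ ()) | chain-ends-at-⊤ c others (λ ())
  ... | X₀≡⊥ , min-⊥ | X₁≡⊤ , min-⊤ , Γ⊤≡⊤
    with another (ℕ.≤-trans 2≤n (covering-minimizer⇒n≤m E Γ⊤≡⊤ min-⊤)) u
  ... | v , v≢u =
    gap c zero ⁅ u ⁆ (singleton-minimizer E min-⊥ u deg≱2)
      ( subst (_⊂ ⁅ u ⁆) (sym X₀≡⊥) (⊥⊂ (x∈⁅x⁆ u))
      , subst (⁅ u ⁆ ⊂_) (sym X₁≡⊤) (⊂⊤ (x≢y⇒x∉⁅y⁆ v≢u)) )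
  -- Any other shape has a nonempty part V_j (j ≥ 1) different from the p-th.
  no-low-degree _ _ c@record { k = suc _ } nothing others _ _
    with proper-part-index c others zero
  ... | ()
  no-low-degree _ _ c@record { k = suc _ } (just zero) others _ _
    with proper-part-index c others zero
  ... | ()
  no-low-degree _ _ c@record { k = suc (suc _) } (just (suc _)) others _ _
    with proper-part-index c others zero | proper-part-index c others (suc zero)
  ... | refl | ()

corollary4p1 : (m n : ℕ) (E : Edges m n) → m ≤ n → 2 ≤ n →
    DMIrreducible E → (u : Fin m) → 2 ≤ ∣ Γ E ⁅ u ⁆ ∣
corollary4p1 m n E m≤n 2≤n (c , p , _ , others) u =
  decidable-stable (2 ≤? ∣ Γ E ⁅ u ⁆ ∣) (no-low-degree m≤n 2≤n c p others u)
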